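{- Let $G$ be a disconnected graph with exactly one nontrivial connected component $G_1$ and $t > 0$ trivial components. If $\mathrm{diam}(G_1) > 3$, then $h(G\overline{G}) = t+2$.
   Context: All graphs are finite, simple and undirected. For a graph $H$ and $x,y \in V(H)$, the closed interval $I[x,y]$ consists of $x$, $y$ and all vertices lying on some shortest path between $x$ and $y$ in $H$; for $S \subseteq V(H)$, $I[S] = \bigcup_{x,y\in S} I[x,y]$. A set $S$ is (geodetically) convex if $I[S]=S$; the convex hull $H(S)$ is the smallest convex set containing $S$; $S$ is a hull set if $H(S)=V(H)$; the (geodetic) hull number $h(H)$ is the minimum cardinality of a hull set of $H$. $\mathrm{diam}$ denotes the diameter. For a graph $G$ with vertex set $\{v_1,\dots,v_n\}$, the complementary prism $G\overline{G}$ has vertex set $\{v_1,\dots,v_n\}\cup\{\overline{v}_1,\dots,\overline{v}_n\}$ and edge set $E(G) \cup \{\overline{v}_i\overline{v}_j : i<j,\ v_iv_j\notin E(G)\} \cup \{v_i\overline{v}_i : 1\le i\le n\}$. A component is trivial if it has exactly one vertex, nontrivial otherwise. -}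

module Defs where

open import Data.Nat using (ℕ; zero; suc; _+_; _<_; _≤_)
open import Data.Bool using (Bool; true; false; not; _∧_)
open import Data.Fin using (Fin; splitAt)
open import Data.Fin.Properties using () renaming (_≟_ to _≟ᶠ_)
open import Data.Fin.Subset using (Subset; _∈_; _∉_; _⊆_; ∣_∣; ∁)
open import Data.Sum using (_⊎_; inj₁; inj₂)
open import Data.Product using (Σ; ∃; ∃-syntax; _×_; _,_)
open import Relation.Nullary using (¬_)
open import Relation.Nullary.Decidable using (⌊_⌋)
open import Relation.Binary.PropositionalEquality using (_≡_)

record Graph (n : ℕ) : Set where
  field
    adj   : Fin n → Fin n → Bool
    sym   : ∀ x y → adj x y ≡ adj y x
    irref : ∀ x → adj x x ≡ false
open Graph public

module _ {n : ℕ} (G : Graph n) where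

  Edge : Fin n → Fin n → Set
  Edge x y = adj G x y ≡ true

  data Walk : Fin n → Fin n → Set where
    [_]  : ∀ x → Walk x x
    _∷_  : ∀ {x y z} → Edge x y → Walk y z → Walk x z

  walkLength : ∀ {x y} → Walk x y → ℕ
  walkLength [ _ ]   = 0
  walkLength (_ ∷ w) = suc (walkLength w)

  data OnWalk (z : Fin n) : ∀ {x y} → Walk x y → Set where
    here-[] : OnWalk z [ z ]
    here    : ∀ {y w} (e : Edge z y) (p : Walk y w) → OnWalk z (e ∷ p)
    there   : ∀ {x y w} (e : Edge x y) {p : Walk y w} → OnWalk z p → OnWalk z (e ∷ p)

  Connected : Fin n → Fin n → Set
  Connected x y = Walk x y

  Dist : Fin n → Fin n → ℕ → Set
  Dist x y d = Σ (Walk x y) (λ w → walkLength w ≡ d)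
             × (∀ (w : Walk x y) → d ≤ walkLength w)

  -- a shortest x–y path (a shortest walk is automatically a path)
  ShortestPath : Fin n → Fin n → Set
  ShortestPath x y = Σ (Walk x y) (λ w → Dist x y (walkLength w))

  InInterval : Fin n → Fin n → Fin n → Set
  InInterval x y z = z ≡ x ⊎ z ≡ y
                   ⊎ Σ (ShortestPath x y) (λ { (w , _) → OnWalk z w })

  Convex : Subset n → Set
  Convex S = ∀ x y z → x ∈ S → y ∈ S → InInterval x y z → z ∈ S

  -- H(S) = V : every convex set containing S is the whole vertex set
  -- (H(S) is the intersection of all convex supersets of S)
  IsHullSet : Subset n → Set
  IsHullSet S = ∀ (C : Subset n) → S ⊆ C → Convex C → ∀ v → v ∈ C

  HullNumber : ℕ → Set
  HullNumber k = (Σ (Subset n) λ S → IsHullSet S × ∣ S ∣ ≡ k)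
               × (∀ S → IsHullSet S → k ≤ ∣ S ∣)

  IsComponent : Subset n → Set
  IsComponent C = (∃[ x ] x ∈ C)
                × (∀ x y → x ∈ C → y ∈ C → Connected x y)
                × (∀ x y → x ∈ C → Edge x y → y ∈ C)

  -- the subgraph induced on component C has diameter > d
  -- (distances within a component coincide with distances in G)
  ComponentDiamGreater : Subset n → ℕ → Set
  ComponentDiamGreater C d =
    ∃[ x ] ∃[ y ] ∃[ e ] (x ∈ C × y ∈ C × Dist x y e × d < e)

-- the complementary prism G Ḡ on Fin (n + n):
-- the first copy is G, the second copy is the complement, v_i ~ v̄_i
cpAdj : ∀ {n} → Graph n → Fin (n + n) → Fin (n + n) → Bool
cpAdj {n} G i j with splitAt n i | splitAt n j
... | inj₁ a | inj₁ b = adj G a b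
... | inj₂ a | inj₂ b = not (adj G a b) ∧ not ⌊ a ≟ᶠ b ⌋
... | inj₁ a | inj₂ b = ⌊ a ≟ᶠ b ⌋
... | inj₂ a | inj₁ b = ⌊ a ≟ᶠ b ⌋

private
  open import Relation.Binary.PropositionalEquality using (refl; cong; cong₂) renaming (sym to ≡sym)
  open import Relation.Nullary using (yes; no)
  open import Data.Empty using (⊥-elim)

  ≟-sym : ∀ {n} (a b : Fin n) → ⌊ a ≟ᶠ b ⌋ ≡ ⌊ b ≟ᶠ a ⌋
  ≟-sym a b with a ≟ᶠ b | b ≟ᶠ a
  ... | yes _ | yes _ = refl
  ... | no _  | no _  = refl
  ... | yes p | no q  = ⊥-elim (q (≡sym p))
  ... | no p  | yes q = ⊥-elim (p (≡sym q))

  ≟-refl : ∀ {n} (a : Fin n) → ⌊ a ≟ᶠ a ⌋ ≡ true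
  ≟-refl a with a ≟ᶠ a
  ... | yes _ = refl
  ... | no p  = ⊥-elim (p refl)

  cpSym : ∀ {n} (G : Graph n) i j → cpAdj G i j ≡ cpAdj G j i
  cpSym {n} G i j with splitAt n i | splitAt n j
  ... | inj₁ a | inj₁ b = Graph.sym G a b
  ... | inj₂ a | inj₂ b = cong₂ (λ u v → not u ∧ not v) (Graph.sym G a b) (≟-sym a b)
  ... | inj₁ a | inj₂ b = ≟-sym a b
  ... | inj₂ a | inj₁ b = ≟-sym a b

  cpIrr : ∀ {n} (G : Graph n) i → cpAdj G i i ≡ false
  cpIrr {n} G i with splitAt n i
  ... | inj₁ a = irref G a
  ... | inj₂ a rewrite ≟-refl a | irref G a = refl

complementaryPrism : ∀ {n} → Graph n → Graph (n + n)
complementaryPrism G = record { adj = cpAdj G ; sym = cpSym G ; irref = cpIrr G }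

¬Edge : ∀ {n} → Graph n → Fin n → Fin n → Set
¬Edge G x y = ¬ Edge G x y

module Submission where

-- Write orig a, bar a for the two copies of a vertex a of G in G Ḡ, and Trivials
-- for {orig u : u ∉ C}.  Each orig u is simplicial (its only neighbour is bar u),
-- so it lies in every hull set.  Upper bound: if x₀ x₁ x₂ x₃ x₄ starts a geodesic
-- of C, then Trivials ∪ {orig x₀, orig x₂} is a hull set; the closure of any convex
-- set containing it is propagated along short geodesics of G Ḡ, first to all bars
-- over C, then to all of C's original copy.  Lower bound: for each vertex v the
-- set Band v of both copies of (V ∖ C) ∪ {v} is convex and proper (|C| ≥ 2), so a
-- hull set needs two vertices outside Trivials, as otherwise it lies in some Band v.

open import Defs
open import Data.Nat using (ℕ; suc; _+_; _<_; _≤_; z≤n; s≤s; s≤s⁻¹)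
open import Data.Nat.Properties
  using (≤-refl; n≤1+n; ≤-reflexive; ≤-trans; m≤n⇒m≤1+n; ≤⇒≯; +-monoˡ-≤; +-monoʳ-<; +-comm; module ≤-Reasoning)
open import Data.Bool using (true)
open import Data.Bool.Properties using () renaming (_≟_ to _≟ᵇ_)
open import Data.Fin using (Fin)
open import Data.Fin.Properties using () renaming (_≟_ to _≟ᶠ_)
open import Data.Fin.Subset using (Subset; _∈_; _∉_; _⊆_; ∣_∣; ∁; ⁅_⁆)
open import Data.Fin.Subset.Properties
  using (_∈?_; x∈⁅x⁆; x∈⁅y⁆⇒x≡y; x≢y⇒x∉⁅y⁆; x∉p⇒x∈∁p; x∈∁p⇒x∉p; x∉∁p⇒x∈p)
open import Data.Product using (Σ; _×_; _,_; proj₁; proj₂)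
open import Data.Sum using (_⊎_; inj₁; inj₂; map₁)
open import Data.Empty using (⊥; ⊥-elim)
open import Relation.Nullary using (¬_; yes; no)
open import Relation.Binary.PropositionalEquality as ≡ using (_≡_; _≢_; refl; cong)

module Geodesics {m : ℕ} (H : Graph m) where

  len : ∀ {x y} → Walk H x y → ℕ
  len = walkLength H

  edge-sym : ∀ {x y} → Edge H x y → Edge H y x
  edge-sym {x} {y} e = ≡.trans (Graph.sym H y x) e

  edge-≢ : ∀ {x y} → Edge H x y → x ≢ y
  edge-≢ {x} e refl with ≡.trans (≡.sym e) (irref H x)
  ... | ()

  Apart : Fin m → Fin m → Set
  Apart x y = x ≢ y × ¬ Edge H x y

  apart-sym : ∀ {x y} → Apart x y → Apart y x
  apart-sym (x≢y , ¬x~y) = (λ eq → x≢y (≡.sym eq)) , (λ e → ¬x~y (edge-sym e))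

  apart-or-close : ∀ x y → Apart x y ⊎ (x ≡ y ⊎ Edge H x y)
  apart-or-close x y with x ≟ᶠ y | adj H x y ≟ᵇ true
  ... | yes x≡y | _        = inj₂ (inj₁ x≡y)
  ... | no _    | yes x~y  = inj₂ (inj₂ x~y)
  ... | no x≢y  | no ¬x~y  = inj₁ (x≢y , ¬x~y)

  FarApart : Fin m → Fin m → Set
  FarApart x y = Apart x y × (∀ z → Edge H x z → ¬ Edge H z y)

  apart-length : ∀ {x y} → Apart x y → (w : Walk H x y) → 2 ≤ len w
  apart-length (x≢y , _)   [ _ ]           = ⊥-elim (x≢y refl)
  apart-length (_ , ¬x~y)  (e ∷ [ _ ])     = ⊥-elim (¬x~y e)
  apart-length _           (_ ∷ (_ ∷ _))   = s≤s (s≤s z≤n)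

  farApart-length : ∀ {x y} → FarApart x y → (w : Walk H x y) → 3 ≤ len w
  farApart-length ((x≢y , _) , _)  [ _ ]                = ⊥-elim (x≢y refl)
  farApart-length ((_ , ¬x~y) , _) (e ∷ [ _ ])          = ⊥-elim (¬x~y e)
  farApart-length (_ , noCommon)   (e ∷ (f ∷ [ _ ]))    = ⊥-elim (noCommon _ e f)
  farApart-length _                (_ ∷ (_ ∷ (_ ∷ _)))  = s≤s (s≤s (s≤s z≤n))

  interval-middle : ∀ {x y z} → Apart x y → Edge H x z → Edge H z y → InInterval H x y z
  interval-middle {y = y} apart e f =
    inj₂ (inj₂ ((path , (path , refl) , apart-length apart) , there e (here f [ y ])))
    where
    path : Walk H _ y
    path = e ∷ (f ∷ [ y ])

  module _ {x y z₁ z₂} (far : FarApart x y) (e : Edge H x z₁) (f : Edge H z₁ z₂) (g : Edge H z₂ y) where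

    private
      path : Walk H x y
      path = e ∷ (f ∷ (g ∷ [ y ]))

      geodesic : ShortestPath H x y
      geodesic = path , (path , refl) , farApart-length far

    interval-second : InInterval H x y z₁
    interval-second = inj₂ (inj₂ (geodesic , there e (here f _)))

    interval-third : InInterval H x y z₂
    interval-third = inj₂ (inj₂ (geodesic , there e (there f (here g _))))

  _++ʷ_ : ∀ {x y z} → Walk H x y → Walk H y z → Walk H x z
  [ _ ]   ++ʷ w = w
  (e ∷ v) ++ʷ w = e ∷ (v ++ʷ w)

  length-++ʷ : ∀ {x y z} (v : Walk H x y) (w : Walk H y z) → len (v ++ʷ w) ≡ len v + len w
  length-++ʷ [ _ ]   w = refl
  length-++ʷ (e ∷ v) w = cong suc (length-++ʷ v w)

  Near : ℕ → Fin m → Fin m → Set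
  Near k p q = Σ (Walk H p q) λ w → len w ≤ k

  HasExit : Subset m → Fin m → Set
  HasExit D p = Σ (Fin m) λ z → z ∉ D × Edge H p z

  ExitsNear : Subset m → Set
  ExitsNear D = ∀ {p q} → p ∈ D → q ∈ D → HasExit D p → HasExit D q → Near 2 p q

  DetoursShort : Subset m → Set
  DetoursShort D = ∀ {p q z} → p ∈ D → q ∈ D → z ∉ D → Edge H p z → Edge H z q → Near 1 p q

  -- Convexity criterion: under these hypotheses every walk between vertices of D
  -- that leaves D can be shortened, so geodesics between vertices of D stay in D.
  module _ (D : Subset m) (exitsNear : ExitsNear D) (detoursShort : DetoursShort D) where

    reentry : ∀ {z y} → z ∉ D → y ∈ D → (w : Walk H z y)
            → Σ (Fin m) λ q → q ∈ D × HasExit D q × Σ (Walk H q y) λ r → len r < len w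
    reentry z∉D y∈D [ _ ] = ⊥-elim (z∉D y∈D)
    reentry {z} z∉D y∈D (_∷_ {y = q} f w) with q ∈? D
    ... | yes q∈D = q , q∈D , (z , z∉D , edge-sym f) , w , ≤-refl
    ... | no q∉D with reentry q∉D y∈D w
    ...   | q′ , q′∈D , exit , r , r<w = q′ , q′∈D , exit , r , m≤n⇒m≤1+n r<w

    -- a walk that starts in D and immediately leaves it can be shortened:
    -- replace the excursion by the short walk given by the hypotheses
    shortcut : ∀ {p z y} → p ∈ D → z ∉ D → y ∈ D → (e : Edge H p z) (w : Walk H z y)
             → Σ (Walk H p y) λ w′ → len w′ < len (e ∷ w)
    shortcut p∈D z∉D y∈D e [ _ ] = ⊥-elim (z∉D y∈D)
    shortcut {p} {z} p∈D z∉D y∈D e (_∷_ {y = q} f w) with q ∈? D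
    ... | yes q∈D with detoursShort p∈D q∈D z∉D e f
    ...   | v , v≤1 = v ++ʷ w , (begin-strict
              len (v ++ʷ w)  ≡⟨ length-++ʷ v w ⟩
              len v + len w  ≤⟨ +-monoˡ-≤ (len w) v≤1 ⟩
              1 + len w      <⟨ ≤-refl ⟩
              2 + len w      ∎)
      where open ≤-Reasoning
    shortcut {p} {z} p∈D z∉D y∈D e (_∷_ {y = q} f w) | no q∉D with reentry q∉D y∈D w
    ...   | q′ , q′∈D , exit , r , r<w with exitsNear p∈D q′∈D (z , z∉D , e) exit
    ...     | v , v≤2 = v ++ʷ r , (begin-strict
              len (v ++ʷ r)  ≡⟨ length-++ʷ v r ⟩
              len v + len r  ≤⟨ +-monoˡ-≤ (len r) v≤2 ⟩
              2 + len r      <⟨ +-monoʳ-< 2 r<w ⟩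
              2 + len w      ∎)
      where open ≤-Reasoning

    geodesic-inside : ∀ {x y z} → x ∈ D → y ∈ D → (w : Walk H x y)
                    → (∀ (w′ : Walk H x y) → len w ≤ len w′) → OnWalk H z w → z ∈ D
    geodesic-inside x∈D y∈D _ minimal here-[]     = x∈D
    geodesic-inside x∈D y∈D _ minimal (here _ _)  = x∈D
    geodesic-inside x∈D y∈D (_∷_ {y = q} e w) minimal (there .e on) with q ∈? D
    ... | yes q∈D = geodesic-inside q∈D y∈D w (λ w′ → s≤s⁻¹ (minimal (e ∷ w′))) on
    ... | no q∉D with shortcut x∈D q∉D y∈D e w
    ...   | w′ , shorter = ⊥-elim (≤⇒≯ (minimal w′) shorter)

    convexity-criterion : Convex H D
    convexity-criterion x y z x∈D y∈D (inj₁ refl)        = x∈D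
    convexity-criterion x y z x∈D y∈D (inj₂ (inj₁ refl)) = y∈D
    convexity-criterion x y z x∈D y∈D (inj₂ (inj₂ ((w , _ , minimal) , on))) =
      geodesic-inside x∈D y∈D w minimal on

  close-near : ∀ {x y} → x ≡ y ⊎ Edge H x y → Near 1 x y
  close-near (inj₁ refl) = [ _ ] , z≤n
  close-near (inj₂ e)    = (e ∷ [ _ ]) , ≤-refl

  Simplicial : Fin m → Set
  Simplicial v = ∀ {p q} → Edge H p v → Edge H q v → Near 1 p q

  simplicial-removal-convex : ∀ v → Simplicial v → Convex H (∁ ⁅ v ⁆)
  simplicial-removal-convex v simplicial =
    convexity-criterion (∁ ⁅ v ⁆) exitsNear detoursShort
    where
    outside⇒v : ∀ {z} → z ∉ ∁ ⁅ v ⁆ → z ≡ v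
    outside⇒v z∉ = x∈⁅y⁆⇒x≡y v (x∉∁p⇒x∈p z∉)

    exitsNear : ExitsNear (∁ ⁅ v ⁆)
    exitsNear _ _ (z , z∉ , e) (z′ , z′∉ , e′)
      with outside⇒v z∉ | outside⇒v z′∉
    ... | refl | refl with simplicial e e′
    ...   | w , w≤1 = w , m≤n⇒m≤1+n w≤1

    detoursShort : DetoursShort (∁ ⁅ v ⁆)
    detoursShort _ _ z∉ e f with outside⇒v z∉
    ... | refl = simplicial e (edge-sym f)

  hull-contains-simplicial : ∀ {S} → IsHullSet H S → ∀ v → Simplicial v → v ∈ S
  hull-contains-simplicial {S} hull v simplicial with v ∈? S
  ... | yes v∈S = v∈S
  ... | no v∉S  = ⊥-elim (x∈∁p⇒x∉p v∈rest (x∈⁅x⁆ v))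
    where
    S⊆rest : S ⊆ ∁ ⁅ v ⁆
    S⊆rest {i} i∈S = x∉p⇒x∈∁p (x≢y⇒x∉⁅y⁆ λ { refl → v∉S i∈S })

    v∈rest : v ∈ ∁ ⁅ v ⁆
    v∈rest = hull (∁ ⁅ v ⁆) S⊆rest (simplicial-removal-convex v simplicial) v

module SubsetFacts where

  open import Data.Vec using ([]; _∷_; _++_; here; there)
  open import Data.Vec.Properties using ([]=⇒lookup; lookup⇒[]=; lookup-++ˡ; lookup-++ʳ)
  open import Data.Fin using (zero; suc; _↑ˡ_; _↑ʳ_)
  open import Data.Fin.Properties using (any?)
  open import Data.Fin.Subset using (_∪_; inside; outside; Nonempty) renaming (⊥ to ∅)
  open import Data.Fin.Subset.Properties
    using (∣⊥∣≡0; ∣⁅x⁆∣≡1; ∪-identityʳ; x∈p∪q⁺; x∈p∪q⁻; p⊆q⇒∣p∣≤∣q∣; nonempty?; Empty-unique)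
  open import Relation.Nullary using (_×-dec_; ¬?)

  ∣p∪⁅x⁆∣ : ∀ {m} (p : Subset m) x → x ∉ p → ∣ p ∪ ⁅ x ⁆ ∣ ≡ suc ∣ p ∣
  ∣p∪⁅x⁆∣ (outside ∷ p) zero    _   rewrite ∪-identityʳ p = refl
  ∣p∪⁅x⁆∣ (inside ∷ p)  zero    x∉p = ⊥-elim (x∉p here)
  ∣p∪⁅x⁆∣ (inside ∷ p)  (suc x) x∉p = cong suc (∣p∪⁅x⁆∣ p x (λ x∈p → x∉p (there x∈p)))
  ∣p∪⁅x⁆∣ (outside ∷ p) (suc x) x∉p = ∣p∪⁅x⁆∣ p x (λ x∈p → x∉p (there x∈p))

  ∣p∪⁅x⁆∪⁅y⁆∣ : ∀ {m} (p : Subset m) {x y} → x ∉ p → y ∉ p → y ≢ x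
              → ∣ (p ∪ ⁅ x ⁆) ∪ ⁅ y ⁆ ∣ ≡ suc (suc ∣ p ∣)
  ∣p∪⁅x⁆∪⁅y⁆∣ p {x} {y} x∉p y∉p y≢x =
    ≡.trans (∣p∪⁅x⁆∣ (p ∪ ⁅ x ⁆) y y∉p∪x) (cong suc (∣p∪⁅x⁆∣ p x x∉p))
    where
    y∉p∪x : y ∉ p ∪ ⁅ x ⁆
    y∉p∪x y∈ with x∈p∪q⁻ p ⁅ x ⁆ y∈
    ... | inj₁ y∈p = y∉p y∈p
    ... | inj₂ y∈x = y≢x (x∈⁅y⁆⇒x≡y x y∈x)

  p∪⁅x⁆∪⁅y⁆⊆ : ∀ {m} {p q : Subset m} {x y} → p ⊆ q → x ∈ q → y ∈ q → (p ∪ ⁅ x ⁆) ∪ ⁅ y ⁆ ⊆ q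
  p∪⁅x⁆∪⁅y⁆⊆ {p = p} {x = x} {y} p⊆q x∈q y∈q {i} i∈ with x∈p∪q⁻ (p ∪ ⁅ x ⁆) ⁅ y ⁆ i∈
  ... | inj₂ i∈y rewrite x∈⁅y⁆⇒x≡y y i∈y = y∈q
  ... | inj₁ i∈p∪x with x∈p∪q⁻ p ⁅ x ⁆ i∈p∪x
  ...   | inj₁ i∈p = p⊆q i∈p
  ...   | inj₂ i∈x rewrite x∈⁅y⁆⇒x≡y x i∈x = x∈q

  TwoOutside : ∀ {m} → Subset m → Subset m → Set
  TwoOutside {m} T S = Σ (Fin m) λ x → Σ (Fin m) λ y → x ∈ S × y ∈ S × x ∉ T × y ∉ T × y ≢ x

  twoOutside-size : ∀ {m} {T S : Subset m} → T ⊆ S → TwoOutside T S → suc (suc ∣ T ∣) ≤ ∣ S ∣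
  twoOutside-size {T = T} T⊆S (x , y , x∈S , y∈S , x∉T , y∉T , y≢x) =
    ≤-trans (≤-reflexive (≡.sym (∣p∪⁅x⁆∪⁅y⁆∣ T x∉T y∉T y≢x)))
            (p⊆q⇒∣p∣≤∣q∣ (p∪⁅x⁆∪⁅y⁆⊆ T⊆S x∈S y∈S))

  -- Either S has two elements outside T, or S ⊆ T ∪ {x} for some x
  -- (the default x₀ serves when S ⊆ T).
  twoOutside-or-cover : ∀ {m} (T S : Subset m) → Fin m
                      → TwoOutside T S ⊎ Σ (Fin m) λ x → ∀ i → i ∈ S → i ∈ T ⊎ i ≡ x
  twoOutside-or-cover T S x₀ with any? (λ i → (i ∈? S) ×-dec ¬? (i ∈? T))
  ... | no noneOutside = inj₂ (x₀ , cover)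
    where
    cover : ∀ i → i ∈ S → i ∈ T ⊎ i ≡ x₀
    cover i i∈S with i ∈? T
    ... | yes i∈T = inj₁ i∈T
    ... | no i∉T  = ⊥-elim (noneOutside (i , i∈S , i∉T))
  ... | yes (x , x∈S , x∉T) with any? (λ i → ((i ∈? S) ×-dec ¬? (i ∈? T)) ×-dec ¬? (i ≟ᶠ x))
  ...   | yes (y , (y∈S , y∉T) , y≢x) = inj₁ (x , y , x∈S , y∈S , x∉T , y∉T , y≢x)
  ...   | no noSecond = inj₂ (x , cover)
    where
    cover : ∀ i → i ∈ S → i ∈ T ⊎ i ≡ x
    cover i i∈S with i ∈? T | i ≟ᶠ x
    ... | yes i∈T | _      = inj₁ i∈T
    ... | no _    | yes i≡x = inj₂ i≡x
    ... | no i∉T  | no i≢x  = ⊥-elim (noSecond (i , (i∈S , i∉T) , i≢x))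

  positive-size-nonempty : ∀ {m} (p : Subset m) → 0 < ∣ p ∣ → Nonempty p
  positive-size-nonempty {m} p 0<∣p∣ with nonempty? p
  ... | yes nonempty = nonempty
  ... | no empty = ⊥-elim (≤⇒≯ (≤-reflexive (≡.trans (cong ∣_∣ (Empty-unique empty)) (∣⊥∣≡0 m))) 0<∣p∣)

  other-member : ∀ {m} (p : Subset m) → 2 ≤ ∣ p ∣ → ∀ x → Σ (Fin m) λ y → y ∈ p × y ≢ x
  other-member p 2≤∣p∣ x with any? (λ y → (y ∈? p) ×-dec ¬? (y ≟ᶠ x))
  ... | yes found = found
  ... | no none = ⊥-elim (≤⇒≯ (≤-trans (p⊆q⇒∣p∣≤∣q∣ p⊆x) (≤-reflexive (∣⁅x⁆∣≡1 x))) 2≤∣p∣)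
    where
    p⊆x : p ⊆ ⁅ x ⁆
    p⊆x {y} y∈p with y ≟ᶠ x
    ... | yes refl = x∈⁅x⁆ y
    ... | no y≢x   = ⊥-elim (none (y , y∈p , y≢x))

  ∈-++⁺ˡ : ∀ {k m} {p : Subset k} {q : Subset m} {a} → a ∈ p → a ↑ˡ m ∈ p ++ q
  ∈-++⁺ˡ {p = p} {q} {a} a∈p = lookup⇒[]= _ (p ++ q) (≡.trans (lookup-++ˡ p q a) ([]=⇒lookup a∈p))

  ∈-++⁻ˡ : ∀ {k m} {p : Subset k} {q : Subset m} {a} → a ↑ˡ m ∈ p ++ q → a ∈ p
  ∈-++⁻ˡ {p = p} {q} {a} a∈ = lookup⇒[]= a p (≡.trans (≡.sym (lookup-++ˡ p q a)) ([]=⇒lookup a∈))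

  ∈-++⁺ʳ : ∀ {k m} {p : Subset k} {q : Subset m} {a} → a ∈ q → k ↑ʳ a ∈ p ++ q
  ∈-++⁺ʳ {p = p} {q} {a} a∈q = lookup⇒[]= _ (p ++ q) (≡.trans (lookup-++ʳ p q a) ([]=⇒lookup a∈q))

  ∈-++⁻ʳ : ∀ {k m} {p : Subset k} {q : Subset m} {a} → k ↑ʳ a ∈ p ++ q → a ∈ q
  ∈-++⁻ʳ {p = p} {q} {a} a∈ = lookup⇒[]= a q (≡.trans (≡.sym (lookup-++ʳ p q a)) ([]=⇒lookup a∈))

  ∣p++∅∣ : ∀ {k m} (p : Subset k) → ∣ p ++ ∅ {m} ∣ ≡ ∣ p ∣
  ∣p++∅∣ {m = m} []  = ∣⊥∣≡0 m
  ∣p++∅∣ (inside ∷ p)  = cong suc (∣p++∅∣ p)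
  ∣p++∅∣ (outside ∷ p) = ∣p++∅∣ p

module Prism {n : ℕ} (G : Graph n) where

  open import Data.Bool using (false)
  open import Data.Fin using (splitAt; _↑ˡ_; _↑ʳ_)
  open import Data.Fin.Properties
    using (splitAt-↑ˡ; splitAt-↑ʳ; splitAt⁻¹-↑ˡ; splitAt⁻¹-↑ʳ; ↑ˡ-injective; ↑ʳ-injective)
  open import Relation.Nullary.Decidable using (⌊_⌋)

  P : Graph (n + n)
  P = complementaryPrism G

  orig : Fin n → Fin (n + n)
  orig a = a ↑ˡ n

  bar : Fin n → Fin (n + n)
  bar a = n ↑ʳ a

  data View : Fin (n + n) → Set where
    isOrig : ∀ a → View (orig a)
    isBar  : ∀ a → View (bar a)

  view : ∀ i → View i
  view i with splitAt n i in eq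
  ... | inj₁ a = ≡.subst View (splitAt⁻¹-↑ˡ eq) (isOrig a)
  ... | inj₂ a = ≡.subst View (splitAt⁻¹-↑ʳ eq) (isBar a)

  orig-injective : ∀ {a c} → orig a ≡ orig c → a ≡ c
  orig-injective {a} {c} = ↑ˡ-injective n a c

  bar-injective : ∀ {a c} → bar a ≡ bar c → a ≡ c
  bar-injective {a} {c} = ↑ʳ-injective n a c

  orig≢bar : ∀ {a c} → orig a ≢ bar c
  orig≢bar {a} {c} eq
    with ≡.trans (≡.sym (splitAt-↑ˡ n a n)) (≡.trans (cong (splitAt n) eq) (splitAt-↑ʳ n n c))
  ... | ()

  private
    decide-≡ : ∀ {a c : Fin n} → ⌊ a ≟ᶠ c ⌋ ≡ true → a ≡ c
    decide-≡ {a} {c} h with a ≟ᶠ c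
    ... | yes a≡c = a≡c
    decide-≡ () | no _

    decide-refl : ∀ (a : Fin n) → ⌊ a ≟ᶠ a ⌋ ≡ true
    decide-refl a with a ≟ᶠ a
    ... | yes _   = refl
    ... | no a≢a = ⊥-elim (a≢a refl)

  orig-edge⁺ : ∀ {a c} → Edge G a c → Edge P (orig a) (orig c)
  orig-edge⁺ {a} {c} e rewrite splitAt-↑ˡ n a n | splitAt-↑ˡ n c n = e

  orig-edge⁻ : ∀ {a c} → Edge P (orig a) (orig c) → Edge G a c
  orig-edge⁻ {a} {c} e rewrite splitAt-↑ˡ n a n | splitAt-↑ˡ n c n = e

  rung : ∀ a → Edge P (orig a) (bar a)
  rung a rewrite splitAt-↑ˡ n a n | splitAt-↑ʳ n n a = decide-refl a

  rung⁻ : ∀ {a c} → Edge P (orig a) (bar c) → a ≡ c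
  rung⁻ {a} {c} e rewrite splitAt-↑ˡ n a n | splitAt-↑ʳ n n c = decide-≡ e

  bar-edge⁺ : ∀ {a c} → ¬ Edge G a c → a ≢ c → Edge P (bar a) (bar c)
  bar-edge⁺ {a} {c} ¬a~c a≢c rewrite splitAt-↑ʳ n n a | splitAt-↑ʳ n n c
    with adj G a c | a ≟ᶠ c
  ... | true  | _        = ⊥-elim (¬a~c refl)
  ... | false | yes a≡c  = ⊥-elim (a≢c a≡c)
  ... | false | no _     = refl

  bar-edge⁻ : ∀ {a c} → Edge P (bar a) (bar c) → ¬ Edge G a c × a ≢ c
  bar-edge⁻ {a} {c} e rewrite splitAt-↑ʳ n n a | splitAt-↑ʳ n n c
    with adj G a c | a ≟ᶠ c | e
  ... | false | no a≢c | _ = (λ ()) , a≢c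
  ... | true  | _      | ()
  ... | false | yes _  | ()

  open Geodesics P using (Apart; edge-sym)

  orig-apart : ∀ {a c} → Geodesics.Apart G a c → Apart (orig a) (orig c)
  orig-apart (a≢c , ¬a~c) = (λ eq → a≢c (orig-injective eq)) , (λ e → ¬a~c (orig-edge⁻ e))

  bar-apart : ∀ {a c} → Edge G a c → Apart (bar a) (bar c)
  bar-apart a~c = (λ eq → Geodesics.edge-≢ G a~c (bar-injective eq)) , (λ e → proj₁ (bar-edge⁻ e) a~c)

module OneNontrivialComponent {n : ℕ} (G : Graph n) (C : Subset n)
  (connected : ∀ x y → x ∈ C → y ∈ C → Connected G x y)
  (closed : ∀ x y → x ∈ C → Edge G x y → y ∈ C)
  (isolated : ∀ v → v ∉ C → ∀ w → ¬Edge G v w) where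

  open import Data.Vec using (_++_)
  open import Data.Fin.Subset using (_∪_) renaming (⊥ to ∅)
  open import Data.Fin.Subset.Properties using (x∈p∪q⁺; x∈p∪q⁻; ∉⊥)
  open Prism G
  open Geodesics P
  open SubsetFacts
  module InG = Geodesics G

  isolated′ : ∀ {a u} → u ∉ C → ¬ Edge G a u
  isolated′ u∉C e = isolated _ u∉C _ (InG.edge-sym e)

  trivial-neighbour : ∀ {u p} → u ∉ C → Edge P p (orig u) → p ≡ bar u
  trivial-neighbour {u} {p} u∉C e with view p
  ... | isOrig c = ⊥-elim (isolated′ u∉C (orig-edge⁻ e))
  ... | isBar c  = cong bar (≡.sym (rung⁻ (edge-sym e)))

  trivial-simplicial : ∀ {u} → u ∉ C → Simplicial (orig u)
  trivial-simplicial u∉C e f with trivial-neighbour u∉C e | trivial-neighbour u∉C f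
  ... | refl | refl = [ _ ] , z≤n

  Trivials : Subset (n + n)
  Trivials = ∁ C ++ ∅

  orig∈Trivials : ∀ {u} → u ∉ C → orig u ∈ Trivials
  orig∈Trivials u∉C = ∈-++⁺ˡ (x∉p⇒x∈∁p u∉C)

  orig∈Trivials⁻ : ∀ {a} → orig a ∈ Trivials → a ∉ C
  orig∈Trivials⁻ a∈ = x∈∁p⇒x∉p (∈-++⁻ˡ a∈)

  bar∉Trivials : ∀ {a} → bar a ∉ Trivials
  bar∉Trivials a∈ = ∉⊥ (∈-++⁻ʳ {p = ∁ C} a∈)

  hull-contains-trivials : ∀ {S} → IsHullSet P S → Trivials ⊆ S
  hull-contains-trivials hull {i} i∈T with view i
  ... | isOrig a = hull-contains-simplicial hull (orig a) (trivial-simplicial (orig∈Trivials⁻ i∈T))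
  ... | isBar a  = ⊥-elim (bar∉Trivials i∈T)

  -- The first five vertices x₀ … x₄ of a geodesic of length ≥ 4 that starts in C,
  -- with the distance information the closure argument uses.
  record LongGeodesic : Set where
    field
      x₀ x₁ x₂ x₃ x₄ : Fin n
      x₀∈C    : x₀ ∈ C
      e₀₁     : Edge G x₀ x₁
      e₁₂     : Edge G x₁ x₂
      e₂₃     : Edge G x₂ x₃
      e₃₄     : Edge G x₃ x₄
      apart₀₂ : InG.Apart x₀ x₂
      apart₁₃ : InG.Apart x₁ x₃
      far₁₄   : InG.FarApart x₁ x₄

  -- A pair at distance d > 3 with x ∈ C yields such a geodesic: each listed
  -- property fails only if some walk x → y is shorter than d.
  long-geodesic : ∀ {x y d} → x ∈ C → Dist G x y d → 3 < d → LongGeodesic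
  long-geodesic _ (([ _ ] , refl) , _) ()
  long-geodesic _ ((_ ∷ [ _ ] , refl) , _) (s≤s ())
  long-geodesic _ ((_ ∷ (_ ∷ [ _ ]) , refl) , _) (s≤s (s≤s ()))
  long-geodesic _ ((_ ∷ (_ ∷ (_ ∷ [ _ ])) , refl) , _) (s≤s (s≤s (s≤s ())))
  long-geodesic {x} {y} x∈C
    ((_∷_ {y = x₁} e₀₁ (_∷_ {y = x₂} e₁₂ (_∷_ {y = x₃} e₂₃ (_∷_ {y = x₄} e₃₄ rest))) , refl) , minimal) _ =
    record
      { x₀ = x ; x₁ = x₁ ; x₂ = x₂ ; x₃ = x₃ ; x₄ = x₄ ; x₀∈C = x∈C
      ; e₀₁ = e₀₁ ; e₁₂ = e₁₂ ; e₂₃ = e₂₃ ; e₃₄ = e₃₄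
      ; apart₀₂ = (λ { refl → tooShort (e₂₃ ∷ (e₃₄ ∷ rest)) saves₂ })
                , (λ f → tooShort (f ∷ (e₂₃ ∷ (e₃₄ ∷ rest))) saves₁)
      ; apart₁₃ = (λ { refl → tooShort (e₀₁ ∷ (e₃₄ ∷ rest)) saves₂ })
                , (λ f → tooShort (e₀₁ ∷ (f ∷ (e₃₄ ∷ rest))) saves₁)
      ; far₁₄   = ( (λ { refl → tooShort (e₀₁ ∷ rest) saves₃ })
                  , (λ f → tooShort (e₀₁ ∷ (f ∷ rest)) saves₂) )
                , (λ _ f g → tooShort (e₀₁ ∷ (f ∷ (g ∷ rest))) saves₁)
      }
    where
    L : ℕ
    L = InG.len rest

    tooShort : (w : Walk G x y) → InG.len w < 4 + L → ⊥
    tooShort w shorter = ≤⇒≯ (minimal w) shorter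

    saves₁ : 3 + L < 4 + L
    saves₁ = ≤-refl

    saves₂ : 2 + L < 4 + L
    saves₂ = ≤-trans (n≤1+n _) saves₁

    saves₃ : 1 + L < 4 + L
    saves₃ = ≤-trans (n≤1+n _) saves₂

  -- Closure rules for a convex set K of G Ḡ containing Trivials (given some trivial
  -- vertex u₀): each rule exhibits a geodesic of G Ḡ between two vertices of K.
  module ClosureRules {u₀ : Fin n} (u₀∉C : u₀ ∉ C)
    (K : Subset (n + n)) (convex : Convex P K) (trivials⊆K : Trivials ⊆ K) where

    -- orig u – bar u – bar a – orig a is a geodesic (d = 3) for u trivial and a ∈ C
    cross : ∀ {u a} → u ∉ C → a ∈ C → orig a ∈ K → bar u ∈ K × bar a ∈ K
    cross {u} {a} u∉C a∈C a∈K =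
        convex _ _ _ u∈K a∈K (interval-second far (rung u) bar-u~bar-a (edge-sym (rung a)))
      , convex _ _ _ u∈K a∈K (interval-third far (rung u) bar-u~bar-a (edge-sym (rung a)))
      where
      u≢a : u ≢ a
      u≢a refl = u∉C a∈C

      u∈K : orig u ∈ K
      u∈K = trivials⊆K (orig∈Trivials u∉C)

      bar-u~bar-a : Edge P (bar u) (bar a)
      bar-u~bar-a = bar-edge⁺ (isolated u u∉C a) u≢a

      noCommon : ∀ z → Edge P (orig u) z → ¬ Edge P z (orig a)
      noCommon z e f with trivial-neighbour u∉C (edge-sym e)
      ... | refl = u≢a (≡.sym (rung⁻ (edge-sym f)))

      far : FarApart (orig u) (orig a)
      far = ( (λ eq → u≢a (orig-injective eq)) , (λ e → isolated u u∉C a (orig-edge⁻ e)) ) , noCommon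

    -- via the geodesic orig u₀ – bar u₀ – bar a – orig a
    lift : ∀ {a} → a ∈ C → orig a ∈ K → bar a ∈ K
    lift a∈C a∈K = proj₂ (cross u₀∉C a∈C a∈K)

    -- orig a – orig c – bar c is a geodesic (d = 2) when a ~ c in G
    descend : ∀ {a c} → orig a ∈ K → Edge G a c → bar c ∈ K → orig c ∈ K
    descend {a} {c} a∈K a~c c∈K =
      convex _ _ _ a∈K c∈K (interval-middle apart (orig-edge⁺ a~c) (rung c))
      where
      apart : Apart (orig a) (bar c)
      apart = orig≢bar , (λ e → InG.edge-≢ a~c (rung⁻ e))

    orig-middle : ∀ {a c d} → orig a ∈ K → orig d ∈ K → InG.Apart a d
                → Edge G a c → Edge G c d → orig c ∈ K
    orig-middle a∈K d∈K apart e f =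
      convex _ _ _ a∈K d∈K (interval-middle (orig-apart apart) (orig-edge⁺ e) (orig-edge⁺ f))

    bar-middle : ∀ {a c d} → bar a ∈ K → bar d ∈ K → Edge G a d
               → InG.Apart a c → InG.Apart c d → bar c ∈ K
    bar-middle a∈K d∈K a~d (a≢c , ¬a~c) (c≢d , ¬c~d) =
      convex _ _ _ a∈K d∈K (interval-middle (bar-apart a~d) (bar-edge⁺ ¬a~c a≢c) (bar-edge⁺ ¬c~d c≢d))

    spread : (∀ {c} → c ∈ C → bar c ∈ K) → ∀ {a c} → a ∈ C → orig a ∈ K → Walk G a c → orig c ∈ K
    spread bars a∈C a∈K [ _ ]     = a∈K
    spread bars a∈C a∈K (e ∷ w) = spread bars (closed _ _ a∈C e) (descend a∈K e (bars (closed _ _ a∈C e))) w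

    everything : (∀ {c} → c ∈ C → bar c ∈ K) → ∀ {a} → a ∈ C → orig a ∈ K → ∀ i → i ∈ K
    everything bars {a} a∈C a∈K i with view i
    ... | isOrig c with c ∈? C
    ...   | yes c∈C = spread bars a∈C a∈K (connected a c a∈C c∈C)
    ...   | no c∉C  = trivials⊆K (orig∈Trivials c∉C)
    everything bars {a} a∈C a∈K i | isBar c with c ∈? C
    ...   | yes c∈C = bars c∈C
    ...   | no c∉C  = proj₁ (cross c∉C a∈C a∈K)

  module _ (seg : LongGeodesic) {u₀ : Fin n} (u₀∉C : u₀ ∉ C) where
    open LongGeodesic seg

    x₁∈C : x₁ ∈ C
    x₁∈C = closed _ _ x₀∈C e₀₁

    x₂∈C : x₂ ∈ C
    x₂∈C = closed _ _ x₁∈C e₁₂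

    x₃∈C : x₃ ∈ C
    x₃∈C = closed _ _ x₂∈C e₂₃

    x₄∈C : x₄ ∈ C
    x₄∈C = closed _ _ x₃∈C e₃₄

    -- any convex K containing Trivials, orig x₀ and orig x₂ is everything:
    -- first orig x₁, then the bars over C (split by position relative to x₁)
    module Closure (K : Subset (n + n)) (convex : Convex P K) (trivials⊆K : Trivials ⊆ K)
                   (x₀∈K : orig x₀ ∈ K) (x₂∈K : orig x₂ ∈ K) where
      open ClosureRules u₀∉C K convex trivials⊆K

      x₁∈K : orig x₁ ∈ K
      x₁∈K = orig-middle x₀∈K x₂∈K apart₀₂ e₀₁ e₁₂

      bar-x₀ : bar x₀ ∈ K
      bar-x₀ = lift x₀∈C x₀∈K

      bar-x₁ : bar x₁ ∈ K
      bar-x₁ = lift x₁∈C x₁∈K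

      bar-x₂ : bar x₂ ∈ K
      bar-x₂ = lift x₂∈C x₂∈K

      -- vertices of C apart from x₁: compare with x₀ and with x₂
      bar-apart-x₁ : ∀ {c} → c ∈ C → InG.Apart c x₁ → bar c ∈ K
      bar-apart-x₁ {c} c∈C c-x₁ with InG.apart-or-close x₀ c
      ... | inj₁ x₀-c         = bar-middle bar-x₀ bar-x₁ e₀₁ x₀-c c-x₁
      ... | inj₂ (inj₁ refl)  = bar-x₀
      ... | inj₂ (inj₂ x₀~c) with InG.apart-or-close x₂ c
      ...   | inj₁ x₂-c        = bar-middle bar-x₂ bar-x₁ (InG.edge-sym e₁₂) x₂-c c-x₁
      ...   | inj₂ (inj₁ refl) = bar-x₂
      ...   | inj₂ (inj₂ x₂~c) = lift c∈C (orig-middle x₀∈K x₂∈K apart₀₂ x₀~c (InG.edge-sym x₂~c))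

      bar-x₃ : bar x₃ ∈ K
      bar-x₃ = bar-apart-x₁ x₃∈C (InG.apart-sym apart₁₃)

      bar-x₄ : bar x₄ ∈ K
      bar-x₄ = bar-apart-x₁ x₄∈C (InG.apart-sym (proj₁ far₁₄))

      x₃∈K : orig x₃ ∈ K
      x₃∈K = descend x₂∈K e₂₃ bar-x₃

      -- neighbours of x₁: compare with x₃ (they are apart from x₄ as d(x₁,x₄) = 3)
      bar-near-x₁ : ∀ {c} → c ∈ C → Edge G x₁ c → bar c ∈ K
      bar-near-x₁ {c} c∈C x₁~c with InG.apart-or-close x₃ c
      ... | inj₁ x₃-c        = bar-middle bar-x₃ bar-x₄ e₃₄ x₃-c c-x₄
        where
        c-x₄ : InG.Apart c x₄
        c-x₄ = (λ { refl → proj₂ (proj₁ far₁₄) x₁~c }) , proj₂ far₁₄ c x₁~c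
      ... | inj₂ (inj₁ refl) = bar-x₃
      ... | inj₂ (inj₂ x₃~c) = lift c∈C (orig-middle x₁∈K x₃∈K apart₁₃ x₁~c (InG.edge-sym x₃~c))

      bars : ∀ {c} → c ∈ C → bar c ∈ K
      bars {c} c∈C with InG.apart-or-close x₁ c
      ... | inj₁ x₁-c        = bar-apart-x₁ c∈C (InG.apart-sym x₁-c)
      ... | inj₂ (inj₁ refl) = bar-x₁
      ... | inj₂ (inj₂ x₁~c) = bar-near-x₁ c∈C x₁~c

      all : ∀ i → i ∈ K
      all = everything bars x₀∈C x₀∈K

    HullSet₀ : Subset (n + n)
    HullSet₀ = (Trivials ∪ ⁅ orig x₀ ⁆) ∪ ⁅ orig x₂ ⁆

    hullSet₀-hull : IsHullSet P HullSet₀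
    hullSet₀-hull K S⊆K convex = Closure.all K convex
      (λ i∈T → S⊆K (x∈p∪q⁺ (inj₁ (x∈p∪q⁺ (inj₁ i∈T)))))
      (S⊆K (x∈p∪q⁺ (inj₁ (x∈p∪q⁺ (inj₂ (x∈⁅x⁆ _))))))
      (S⊆K (x∈p∪q⁺ (inj₂ (x∈⁅x⁆ _))))

    hullSet₀-size : ∣ HullSet₀ ∣ ≡ suc (suc ∣ Trivials ∣)
    hullSet₀-size = ∣p∪⁅x⁆∪⁅y⁆∣ Trivials (not-trivial x₀∈C) (not-trivial x₂∈C)
                      (λ eq → proj₁ apart₀₂ (≡.sym (orig-injective eq)))
      where
      not-trivial : ∀ {a} → a ∈ C → orig a ∉ Trivials
      not-trivial a∈C a∈T = orig∈Trivials⁻ a∈T a∈C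

  -- For a vertex v, Core v = (V ∖ C) ∪ {v} is independent in G, so the
  -- bars over it form a clique of Ḡ; both copies of Core v together form a convex
  -- set Band v, which misses orig w for every w ∈ C other than v.
  Core : Fin n → Subset n
  Core v = ∁ C ∪ ⁅ v ⁆

  Band : Fin n → Subset (n + n)
  Band v = Core v ++ Core v

  core-independent : ∀ {v a c} → a ∈ Core v → c ∈ Core v → ¬ Edge G a c
  core-independent {v} {a} {c} a∈ c∈ a~c with x∈p∪q⁻ (∁ C) ⁅ v ⁆ a∈ | x∈p∪q⁻ (∁ C) ⁅ v ⁆ c∈
  ... | inj₁ a∉C | _       = isolated a (x∈∁p⇒x∉p a∉C) c a~c
  ... | inj₂ _   | inj₁ c∉C = isolated′ (x∈∁p⇒x∉p c∉C) a~c
  ... | inj₂ a≡v | inj₂ c≡v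
    rewrite x∈⁅y⁆⇒x≡y v a≡v | x∈⁅y⁆⇒x≡y v c≡v = InG.edge-≢ a~c refl

  core-bars-close : ∀ {v a c} → a ∈ Core v → c ∈ Core v → a ≡ c ⊎ Edge P (bar a) (bar c)
  core-bars-close {a = a} {c} a∈ c∈ with a ≟ᶠ c
  ... | yes a≡c = inj₁ a≡c
  ... | no a≢c  = inj₂ (bar-edge⁺ (core-independent a∈ c∈) a≢c)

  v∈Core : ∀ v → v ∈ Core v
  v∈Core v = x∈p∪q⁺ (inj₂ (x∈⁅x⁆ v))

  -- a vertex of Band v with a neighbour outside Band v is orig v or a bar over Core v
  Port : Fin n → Fin (n + n) → Set
  Port v p = p ≡ orig v ⊎ Σ (Fin n) λ c → c ∈ Core v × p ≡ bar c

  exit-via-orig : ∀ {v p a} → p ∈ Band v → orig a ∉ Band v → Edge P p (orig a) → p ≡ orig v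
  exit-via-orig {v} {p} p∈ a∉ e with view p
  ... | isBar c with rung⁻ (edge-sym e)
  ...   | refl = ⊥-elim (a∉ (∈-++⁺ˡ (∈-++⁻ʳ {p = Core v} p∈)))
  exit-via-orig {v} {p} p∈ a∉ e | isOrig c with x∈p∪q⁻ (∁ C) ⁅ v ⁆ (∈-++⁻ˡ p∈)
  ...   | inj₁ c∉C = ⊥-elim (isolated c (x∈∁p⇒x∉p c∉C) _ (orig-edge⁻ e))
  ...   | inj₂ c≡v = cong orig (x∈⁅y⁆⇒x≡y v c≡v)

  exit-via-bar : ∀ {v p a} → p ∈ Band v → bar a ∉ Band v → Edge P p (bar a)
               → Σ (Fin n) λ c → c ∈ Core v × p ≡ bar c
  exit-via-bar {v} {p} p∈ a∉ e with view p
  ... | isBar c = c , ∈-++⁻ʳ {p = Core v} p∈ , refl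
  ... | isOrig c with rung⁻ e
  ...   | refl = ⊥-elim (a∉ (∈-++⁺ʳ (∈-++⁻ˡ {q = Core v} p∈)))

  exit-port : ∀ {v p} → p ∈ Band v → HasExit (Band v) p → Port v p
  exit-port p∈ (z , z∉ , e) with view z
  ... | isOrig a = inj₁ (exit-via-orig p∈ z∉ e)
  ... | isBar a  = inj₂ (exit-via-bar p∈ z∉ e)

  -- any two ports are joined through the clique of bars (and the rung at v)
  ports-near : ∀ {v p q} → Port v p → Port v q → Near 2 p q
  ports-near (inj₁ refl) (inj₁ refl) = [ _ ] , z≤n
  ports-near {v} (inj₁ refl) (inj₂ (c , c∈ , refl)) with core-bars-close (v∈Core v) c∈
  ... | inj₁ refl = (rung v ∷ [ _ ]) , s≤s z≤n
  ... | inj₂ e    = (rung v ∷ (e ∷ [ _ ])) , ≤-refl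
  ports-near {v} (inj₂ (c , c∈ , refl)) (inj₁ refl) with core-bars-close c∈ (v∈Core v)
  ... | inj₁ refl = (edge-sym (rung v) ∷ [ _ ]) , s≤s z≤n
  ... | inj₂ e    = (e ∷ (edge-sym (rung v) ∷ [ _ ])) , ≤-refl
  ports-near (inj₂ (c , c∈ , refl)) (inj₂ (c′ , c′∈ , refl))
    with close-near (map₁ (cong bar) (core-bars-close c∈ c′∈))
  ... | w , w≤1 = w , m≤n⇒m≤1+n w≤1

  band-convex : ∀ v → Convex P (Band v)
  band-convex v = convexity-criterion (Band v) exitsNear detoursShort
    where
    exitsNear : ExitsNear (Band v)
    exitsNear p∈ q∈ p-exit q-exit = ports-near (exit-port p∈ p-exit) (exit-port q∈ q-exit)

    detoursShort : DetoursShort (Band v)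
    detoursShort {z = z} p∈ q∈ z∉ e f with view z
    ... | isOrig a with exit-via-orig p∈ z∉ e | exit-via-orig q∈ z∉ (edge-sym f)
    ...   | refl | refl = [ _ ] , z≤n
    detoursShort {z = z} p∈ q∈ z∉ e f | isBar a
      with exit-via-bar p∈ z∉ e | exit-via-bar q∈ z∉ (edge-sym f)
    ...   | c , c∈ , refl | c′ , c′∈ , refl = close-near (map₁ (cong bar) (core-bars-close c∈ c′∈))

  in-own-band : ∀ p → Σ (Fin n) λ v → p ∈ Band v
  in-own-band p with view p
  ... | isOrig a = a , ∈-++⁺ˡ (v∈Core a)
  ... | isBar a  = a , ∈-++⁺ʳ (v∈Core a)

  trivials⊆band : ∀ {v} → Trivials ⊆ Band v
  trivials⊆band {v} {i} i∈ with view i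
  ... | isOrig a = ∈-++⁺ˡ (x∈p∪q⁺ (inj₁ (∈-++⁻ˡ {q = ∅} i∈)))
  ... | isBar a  = ⊥-elim (bar∉Trivials i∈)

  band-misses : ∀ {v w} → w ∈ C → w ≢ v → orig w ∉ Band v
  band-misses {v} w∈C w≢v w∈ with x∈p∪q⁻ (∁ C) ⁅ v ⁆ (∈-++⁻ˡ w∈)
  ... | inj₁ w∉C = x∈∁p⇒x∉p w∉C w∈C
  ... | inj₂ w≡v = w≢v (x∈⁅y⁆⇒x≡y v w≡v)

  -- A hull set contains two vertices besides Trivials: otherwise it lies in some Band v.
  hull-two-outside : 2 ≤ ∣ C ∣ → Fin (n + n) → ∀ {S} → IsHullSet P S → TwoOutside Trivials S
  hull-two-outside 2≤∣C∣ p₀ {S} hull with twoOutside-or-cover Trivials S p₀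
  ... | inj₁ two = two
  ... | inj₂ (x , cover) with in-own-band x
  ...   | v , x∈ with other-member C 2≤∣C∣ v
  ...     | w , w∈C , w≢v = ⊥-elim (band-misses w∈C w≢v (hull (Band v) S⊆band (band-convex v) (orig w)))
    where
    S⊆band : S ⊆ Band v
    S⊆band {i} i∈S with cover i i∈S
    ... | inj₁ i∈T = trivials⊆band i∈T
    ... | inj₂ refl = x∈

  ∣Trivials∣ : ∣ Trivials ∣ ≡ ∣ ∁ C ∣
  ∣Trivials∣ = ∣p++∅∣ (∁ C)

  hull-number : LongGeodesic → ∀ {u₀} → u₀ ∉ C → 2 ≤ ∣ C ∣ → HullNumber P (2 + ∣ ∁ C ∣)
  hull-number seg u₀∉C 2≤∣C∣ = (HullSet₀ seg u₀∉C , hullSet₀-hull seg u₀∉C , size₀) , lower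
    where
    size₀ : ∣ HullSet₀ seg u₀∉C ∣ ≡ 2 + ∣ ∁ C ∣
    size₀ = ≡.trans (hullSet₀-size seg u₀∉C) (cong (2 +_) ∣Trivials∣)

    lower : ∀ S → IsHullSet P S → 2 + ∣ ∁ C ∣ ≤ ∣ S ∣
    lower S hull = ≡.subst (λ k → 2 + k ≤ ∣ S ∣) ∣Trivials∣
      (twoOutside-size (hull-contains-trivials hull)
                       (hull-two-outside 2≤∣C∣ (orig (LongGeodesic.x₀ seg)) hull))

corollary1 : ∀ {n : ℕ} (G : Graph n) (C : Subset n) (t : ℕ)
    → IsComponent G C
    → 2 ≤ ∣ C ∣
    → (∀ v → v ∉ C → ∀ w → ¬Edge G v w)
    → ∣ ∁ C ∣ ≡ t
    → 0 < t
    → ComponentDiamGreater G C 3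
    → HullNumber (complementaryPrism G) (t + 2)
corollary1 G C t (_ , connected , closed) 2≤∣C∣ isolated ∣∁C∣≡t 0<t (x , y , d , x∈C , _ , dist , 3<d)
  with SubsetFacts.positive-size-nonempty (∁ C) (≡.subst (0 <_) (≡.sym ∣∁C∣≡t) 0<t)
... | u₀ , u₀∈∁C =
  ≡.subst (HullNumber (complementaryPrism G)) (≡.trans (cong (2 +_) ∣∁C∣≡t) (+-comm 2 t))
    (hull-number (long-geodesic x∈C dist 3<d) (x∈∁p⇒x∉p u₀∈∁C) 2≤∣C∣)
  where open OneNontrivialComponent G C connected closed isolated
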